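{- Let $J_3:\mathbb{N}\to\mathbb{N}$ be the Josephus function with reduction constant $3$, and let $\{n_p^{(\ell)}\}_{\ell\in\mathbb{N}}$ be the strictly increasing enumeration of the fixed points of $J_3$ (so $n_p^{(1)}=1$). For each $\ell$, let $\overline{m}_\ell$ denote the number of pure high extremal points $n$ of $J_3$ with $n_p^{(\ell)}<n<n_p^{(\ell+1)}$. Then for each $\ell\in\mathbb{N}$, \[ \overline{m}_\ell=\max\{m\in\mathbb{Z}_{\ge 0} : 2^m \text{ divides } 3n_p^{(\ell)}+2\}, \] and \[ n_p^{(\ell+1)}=\frac{3^{\overline{m}_\ell}\,(3n_p^{(\ell)}+2)-2^{\overline{m}_\ell}}{2^{\overline{m}_\ell+1}}. \]
   Context: The Josephus function $J_3$: for $n\in\mathbb{N}=\{1,2,\dots\}$, place $n$ people numbered $1,\dots,n$ clockwise in a circle; starting the count at person $1$ and proceeding clockwise, eliminate every third person (the first eliminated is person $3$), the circle closing ranks after each elimination, until one person remains; $J_3(n)$ is the original number of the survivor. Equivalently $J_3(1)=1$ and $J_3(n)=((J_3(n-1)+2)\bmod n)+1$ for $n\ge 2$. A positive integer $n$ is a fixed point of $J_3$ if $J_3(n)=n$, and a pure high extremal point if $J_3(n)=n-1$. (It is known that $J_3$ has infinitely many fixed points.) -}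

module Defs where

open import Data.Nat using (ℕ; zero; suc; _+_; _≤_; _<_; _<?_)
open import Data.Nat.DivMod using (_%_)
open import Data.Nat.Properties using (_≟_)
open import Data.List using (List; length; filter; upTo)
open import Data.Product using (_×_)
open import Relation.Binary.PropositionalEquality using (_≡_)
open import Relation.Nullary.Decidable using (_×-dec_)

-- Josephus function with reduction constant 3:
-- J3 1 = 1, J3 n = ((J3 (n-1) + 2) mod n) + 1 for n ≥ 2.
-- The value at 0 is an irrelevant convention (0 is not in the paper's ℕ).
J3 : ℕ → ℕ
J3 zero = zero
J3 (suc zero) = 1
J3 (suc (suc k)) = ((J3 (suc k) + 2) % suc (suc k)) + 1

IsFixedPoint : ℕ → Set
IsFixedPoint n = (1 ≤ n) × (J3 n ≡ n)

-- n is a pure high extremal point: J3 n = n - 1 (with n ≥ 1; J3 n + 1 = n forces this)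
IsPureHighExtremal : ℕ → Set
IsPureHighExtremal n = J3 n + 1 ≡ n

countPHE : ℕ → ℕ → ℕ
countPHE a b = length (filter (λ n → (a <? n) ×-dec (J3 n + 1 ≟ n)) (upTo b))

{-# OPTIONS --safe #-}
module Submission where

-- Write the gap of J3 at N as g with J3 N + g ≡ N. While g ≥ 2 the count of three does not wrap
-- around the circle, so J3 grows by 3 and g drops by 2. A fixed point n resets J3 to 2 (gap n − 1
-- at n + 1) and a pure high extremal point p resets it to 1 (gap p at p + 1). From a fixed point n
-- the gap therefore runs down either to 0, giving the next fixed point b with 2b + 1 = 3n + 2, or
-- to 1, giving a pure high extremal point p with 2(p + 1) = 3n + 2. From such a p the same happens
-- with p + 1 in place of (3n + 2)/2: an odd p + 1 leads to a fixed point b with 2b + 1 = 3(p + 1),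
-- an even one to a pure high extremal point p′ with p′ + 1 = 3(p + 1)/2. Writing 3n + 2 = 2^m o
-- with o odd, the second alternative occurs exactly m times and 2b + 1 = 3^m o at the end.

open import Defs
open import Data.Nat using (ℕ; zero; suc; _+_; _*_; _^_; _≤_; _<_; _<?_; z≤n; s≤s; z<s)
open import Data.Nat.Properties
open import Data.Nat.DivMod using (_%_; m<n⇒m%n≡m; n%n≡0; [m+n]%n≡m%n)
open import Data.Nat.Divisibility using (_∣_; divides; m∣m*n; ∣-trans; *-cancelˡ-∣)
open import Data.Nat.Induction using (Acc; acc; <-wellFounded)
open import Data.Nat.Tactic.RingSolver using (solve-∀)
open import Data.List using ([]; _∷_; length; filter; upTo; _++_)
open import Data.List.Properties using (upTo-∷ʳ; filter-++; length-++; filter-accept; filter-reject)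
open import Data.Product using (_×_; ∃; ∃₂; _,_)
open import Data.Sum using (_⊎_; inj₁; inj₂)
open import Relation.Nullary using (¬_; yes; no; contradiction)
open import Relation.Nullary.Decidable using (_×-dec_)
open import Relation.Binary.PropositionalEquality
open import Relation.Binary.Definitions using (tri<; tri≈; tri>)
import Relation.Unary as U

even-or-odd : ∀ n → ∃ λ t → n ≡ 2 * t ⊎ n ≡ 1 + 2 * t
even-or-odd zero = 0 , inj₁ refl
even-or-odd (suc n) with even-or-odd n
... | t , inj₁ refl = t , inj₂ refl
... | t , inj₂ refl = suc t , inj₁ (sym (*-distribˡ-+ 2 1 t))

odd-part : ∀ n → ∃₂ λ m s → suc n ≡ 2 ^ m * (1 + 2 * s)
odd-part n = odd-part-acc n (<-wellFounded n)
  where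
  halve : ∀ t → 2 * suc t ≡ suc (t + suc t)
  halve = solve-∀
  odd-part-acc : ∀ n → Acc _<_ n → ∃₂ λ m s → suc n ≡ 2 ^ m * (1 + 2 * s)
  odd-part-acc n (acc rec) with even-or-odd (suc n)
  ... | t , inj₂ e = 0 , t , trans e (sym (*-identityˡ _))
  ... | zero , inj₁ ()
  ... | suc t , inj₁ e with odd-part-acc t (rec t<n)
    where
    t<n : t < n
    t<n = subst (t <_) (sym (suc-injective (trans e (halve t)))) (m<m+n t z<s)
  ...   | m , s , e′ =
    suc m , s , trans e (trans (cong (2 *_) e′) (sym (*-assoc 2 (2 ^ m) (1 + 2 * s))))

2^k∣2^m*odd⇒k≤m : ∀ m s k → 2 ^ k ∣ 2 ^ m * (1 + 2 * s) → k ≤ m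
2^k∣2^m*odd⇒k≤m m s k 2^k∣y with k ≤? m
... | yes k≤m = k≤m
... | no k≰m with m≤n⇒∃[o]m+o≡n (≰⇒> k≰m)
...   | d , refl = contradiction 2∣odd λ (divides c e) → even≢odd c s (trans (*-comm 2 c) (sym e))
  where
  2^[1+m]∣2^k : 2 ^ suc m ∣ 2 ^ (suc m + d)
  2^[1+m]∣2^k = subst (2 ^ suc m ∣_) (sym (^-distribˡ-+-* 2 (suc m) d)) (m∣m*n (2 ^ d))
  2∣odd : 2 ∣ 1 + 2 * s
  2∣odd = *-cancelˡ-∣ (2 ^ m) {{m^n≢0 2 m}}
    (subst (_∣ 2 ^ m * (1 + 2 * s)) (*-comm 2 (2 ^ m)) (∣-trans 2^[1+m]∣2^k 2^k∣y))

max-power-of-2-dividing : ∀ {y} m s → y ≡ 2 ^ m * (1 + 2 * s)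
                        → (2 ^ m ∣ y) × (∀ k → 2 ^ k ∣ y → k ≤ m)
max-power-of-2-dividing m s refl =
  divides (1 + 2 * s) (*-comm (2 ^ m) _) , λ k → 2^k∣2^m*odd⇒k≤m m s k

power-formula : ∀ m {y b o} → y ≡ 2 ^ m * o → 2 * b + 1 ≡ 3 ^ m * o
              → 2 ^ (m + 1) * b + 2 ^ m ≡ 3 ^ m * y
power-formula m {y} {b} {o} y≡ b≡ = begin
    2 ^ (m + 1) * b + 2 ^ m  ≡⟨ cong (λ e → 2 ^ e * b + 2 ^ m) (+-comm m 1) ⟩
    2 * 2 ^ m * b + 2 ^ m    ≡⟨ factor (2 ^ m) b ⟩
    2 ^ m * (2 * b + 1)      ≡⟨ cong (2 ^ m *_) b≡ ⟩
    2 ^ m * (3 ^ m * o)      ≡⟨ swap (2 ^ m) (3 ^ m) o ⟩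
    3 ^ m * (2 ^ m * o)      ≡⟨ cong (3 ^ m *_) (sym y≡) ⟩
    3 ^ m * y                ∎
  where
  open ≡-Reasoning
  factor : ∀ X b → 2 * X * b + X ≡ X * (2 * b + 1)
  factor = solve-∀
  swap : ∀ X Y o → X * (Y * o) ≡ Y * (X * o)
  swap = solve-∀

Next : (ℕ → Set) → ℕ → ℕ → Set
Next P a b = a < b × P b × (∀ k → a < k → k < b → ¬ P k)

Next-extendˡ : ∀ {P a c b} → a < c → (∀ k → a < k → k ≤ c → ¬ P k) → Next P c b → Next P a b
Next-extendˡ {P} {a} {c} {b} a<c ¬P-upto-c (c<b , Pb , ¬P-after-c) =
  <-trans a<c c<b , Pb , ¬P-between
  where
  ¬P-between : ∀ k → a < k → k < b → ¬ P k
  ¬P-between k a<k k<b with ≤-<-connex k c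
  ... | inj₁ k≤c = ¬P-upto-c k a<k k≤c
  ... | inj₂ c<k = ¬P-after-c k c<k k<b

module _ (f : ℕ → ℕ) (f-< : ∀ ℓ → f ℓ < f (suc ℓ)) where

  strictly-increasing⇒mono : ∀ {i j} → i ≤ j → f i ≤ f j
  strictly-increasing⇒mono {j = zero} z≤n = ≤-refl
  strictly-increasing⇒mono {j = suc j} i≤1+j with m≤n⇒m<n∨m≡n i≤1+j
  ... | inj₁ i<1+j = ≤-trans (strictly-increasing⇒mono (≤-pred i<1+j)) (<⇒≤ (f-< j))
  ... | inj₂ refl = ≤-refl

  enumeration-Next : ∀ {P} → (∀ ℓ → P (f ℓ)) → (∀ n → P n → ∃ λ ℓ → f ℓ ≡ n)
                   → ∀ ℓ {b} → Next P (f ℓ) b → f (suc ℓ) ≡ b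
  enumeration-Next P-f f-onto ℓ {b} (fℓ<b , Pb , ¬P-between) with <-cmp (f (suc ℓ)) b
  ... | tri≈ _ eq _ = eq
  ... | tri< f1+ℓ<b _ _ = contradiction (P-f (suc ℓ)) (¬P-between (f (suc ℓ)) (f-< ℓ) f1+ℓ<b)
  ... | tri> _ _ b<f1+ℓ with f-onto b Pb
  ...   | j , refl with j ≤? ℓ
  ...     | yes j≤ℓ = contradiction (strictly-increasing⇒mono j≤ℓ) (<⇒≱ fℓ<b)
  ...     | no j≰ℓ = contradiction (strictly-increasing⇒mono (≰⇒> j≰ℓ)) (<⇒≱ b<f1+ℓ)

J3-descend : ∀ n g → J3 n + suc (suc g) ≡ n → J3 (suc n) + g ≡ suc n
J3-descend zero g ()
J3-descend (suc k) g h = begin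
    (J3 (suc k) + 2) % suc (suc k) + 1 + g
  ≡⟨ cong (λ x → x + 1 + g) (m<n⇒m%n≡m (s≤s no-wrap)) ⟩
    J3 (suc k) + 2 + 1 + g
  ≡⟨ regroup (J3 (suc k)) g ⟩
    suc (J3 (suc k) + suc (suc g))
  ≡⟨ cong suc h ⟩
    suc (suc k) ∎
  where
  open ≡-Reasoning
  regroup : ∀ x g → x + 2 + 1 + g ≡ suc (x + suc (suc g))
  regroup = solve-∀
  no-wrap : J3 (suc k) + 2 ≤ suc k
  no-wrap = subst (J3 (suc k) + 2 ≤_) h (+-monoʳ-≤ (J3 (suc k)) (s≤s (s≤s z≤n)))

J3-run : ∀ {N} t {r} → J3 N + (r + 2 * t) ≡ N → J3 (N + t) + r ≡ N + t
J3-run {N} zero {r} h = subst (λ x → J3 x + r ≡ x) (sym (+-identityʳ N))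
  (subst (λ g → J3 N + g ≡ N) (+-identityʳ r) h)
J3-run {N} (suc t) {r} h = subst (λ x → J3 x + r ≡ x) (sym (+-suc N t))
  (J3-run t (J3-descend N (r + 2 * t) (subst (λ g → J3 N + g ≡ N) (unfold r t) h)))
  where
  unfold : ∀ r t → r + 2 * suc t ≡ suc (suc (r + 2 * t))
  unfold = solve-∀

J3-run-deep : ∀ {N t r k} → J3 N + (r + 2 * t) ≡ N → N ≤ k → k < N + t → J3 k + 2 ≤ k
J3-run-deep {N} {t} {r} {k} h N≤k k<N+t with m≤n⇒∃[o]m+o≡n N≤k
... | i , refl with m≤n⇒∃[o]m+o≡n (+-cancelˡ-< N i t k<N+t)
... | d , refl = subst (J3 (N + i) + 2 ≤_) at-i (+-monoʳ-≤ (J3 (N + i)) (m≤m+n 2 (r + 2 * d)))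
  where
  split : ∀ r i d → r + 2 * (suc i + d) ≡ (2 + (r + 2 * d)) + 2 * i
  split = solve-∀
  at-i : J3 (N + i) + (2 + (r + 2 * d)) ≡ N + i
  at-i = J3-run i (subst (λ g → J3 N + g ≡ N) (split r i d) h)

deep⇒¬fixed : ∀ {k} → J3 k + 2 ≤ k → ¬ IsFixedPoint k
deep⇒¬fixed {k} deep (_ , fixed) = m+1+n≰m k (subst (λ x → x + 2 ≤ k) fixed deep)

deep⇒¬PHE : ∀ {k} → J3 k + 2 ≤ k → ¬ IsPureHighExtremal k
deep⇒¬PHE {k} deep phe = n≮n k (subst (_≤ k) (trans (+-suc (J3 k) 1) (cong suc phe)) deep)

J3-after-fixed : ∀ n → J3 (suc n) ≡ suc n → J3 (suc (suc n)) ≡ 2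
J3-after-fixed n h = begin
    (J3 (suc n) + 2) % suc (suc n) + 1
  ≡⟨ cong (λ x → (x + 2) % suc (suc n) + 1) h ⟩
    (suc n + 2) % suc (suc n) + 1
  ≡⟨ cong (λ x → x % suc (suc n) + 1) (+-comm (suc n) 2) ⟩
    (1 + suc (suc n)) % suc (suc n) + 1
  ≡⟨ cong (_+ 1) ([m+n]%n≡m%n 1 (suc (suc n))) ⟩
    1 % suc (suc n) + 1
  ≡⟨ cong (_+ 1) (m<n⇒m%n≡m {n = suc (suc n)} (s≤s (s≤s z≤n))) ⟩
    2 ∎
  where open ≡-Reasoning

J3-after-PHE : ∀ n → IsPureHighExtremal (suc n) → J3 (suc (suc n)) ≡ 1
J3-after-PHE n h = begin
    (J3 (suc n) + 2) % suc (suc n) + 1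
  ≡⟨ cong (λ x → (x + 2) % suc (suc n) + 1) (suc-injective (trans (+-comm 1 _) h)) ⟩
    (n + 2) % suc (suc n) + 1
  ≡⟨ cong (λ x → x % suc (suc n) + 1) (+-comm n 2) ⟩
    suc (suc n) % suc (suc n) + 1
  ≡⟨ cong (_+ 1) (n%n≡0 (suc (suc n))) ⟩
    1 ∎
  where open ≡-Reasoning

J3-gap-after-fixed : ∀ n → J3 (suc n) ≡ suc n → J3 (suc (suc n)) + n ≡ suc (suc n)
J3-gap-after-fixed n fixed = cong (_+ n) (J3-after-fixed n fixed)

J3-gap-after-PHE : ∀ {p} → IsPureHighExtremal p → J3 (suc p) + p ≡ suc p
J3-gap-after-PHE {zero} ()
J3-gap-after-PHE {suc n} phe = cong (_+ suc n) (J3-after-PHE n phe)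

PHE-above? : ∀ a → U.Decidable (λ n → a < n × IsPureHighExtremal n)
PHE-above? a n = (a <? n) ×-dec (J3 n + 1 ≟ n)

countPHE-suc : ∀ a b
             → countPHE a (suc b) ≡ countPHE a b + length (filter (PHE-above? a) (b ∷ []))
countPHE-suc a b = begin
    length (filter (PHE-above? a) (upTo (suc b)))
  ≡⟨ cong (λ ns → length (filter (PHE-above? a) ns)) (sym (upTo-∷ʳ b)) ⟩
    length (filter (PHE-above? a) (upTo b ++ b ∷ []))
  ≡⟨ cong length (filter-++ (PHE-above? a) (upTo b) (b ∷ [])) ⟩
    length (filter (PHE-above? a) (upTo b) ++ filter (PHE-above? a) (b ∷ []))
  ≡⟨ length-++ (filter (PHE-above? a) (upTo b)) ⟩
    countPHE a b + length (filter (PHE-above? a) (b ∷ [])) ∎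
  where open ≡-Reasoning

countPHE-skip : ∀ {a b} → ¬ (a < b × IsPureHighExtremal b) → countPHE a (suc b) ≡ countPHE a b
countPHE-skip {a} {b} ¬counted = trans (countPHE-suc a b)
  (trans (cong (λ ns → countPHE a b + length ns) (filter-reject (PHE-above? a) ¬counted))
         (+-identityʳ _))

countPHE-hit : ∀ {a b} → a < b → IsPureHighExtremal b → countPHE a (suc b) ≡ suc (countPHE a b)
countPHE-hit {a} {b} a<b phe = trans (countPHE-suc a b)
  (trans (cong (λ ns → countPHE a b + length ns) (filter-accept (PHE-above? a) (a<b , phe)))
         (+-comm _ 1))

countPHE-empty : ∀ a b → b ≤ suc a → countPHE a b ≡ 0
countPHE-empty a zero _ = refl
countPHE-empty a (suc b) b<sa =
  trans (countPHE-skip {a} (λ (a<b , _) → n≮n a (<-≤-trans a<b (≤-pred b<sa))))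
        (countPHE-empty a b (≤-trans (n≤1+n b) b<sa))

countPHE-stable : ∀ {a N} t → (∀ k → N ≤ k → k < N + t → ¬ IsPureHighExtremal k)
                → countPHE a (N + t) ≡ countPHE a N
countPHE-stable {a} {N} zero _ = cong (countPHE a) (+-identityʳ N)
countPHE-stable {a} {N} (suc t) ¬phe = begin
    countPHE a (N + suc t)
  ≡⟨ cong (countPHE a) (+-suc N t) ⟩
    countPHE a (suc (N + t))
  ≡⟨ countPHE-skip {a} (λ (_ , phe) → ¬phe (N + t) (m≤m+n N t) (+-monoʳ-< N ≤-refl) phe) ⟩
    countPHE a (N + t)
  ≡⟨ countPHE-stable t (λ k N≤k k<N+t → ¬phe k N≤k (<-trans k<N+t (+-monoʳ-< N ≤-refl))) ⟩
    countPHE a N ∎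
  where open ≡-Reasoning

run-to-fixed : ∀ {a} t → J3 (suc a) + 2 * t ≡ suc a
             → Next IsFixedPoint a (suc a + t) × (∀ c → countPHE c (suc a + t) ≡ countPHE c (suc a))
run-to-fixed {a} t h =
  (s≤s (m≤m+n a t) , (s≤s z≤n , fixed) ,
   λ k a<k k<b → deep⇒¬fixed (J3-run-deep {r = 0} h a<k k<b)) ,
  λ c → countPHE-stable t (λ k a<k k<b → deep⇒¬PHE (J3-run-deep {r = 0} h a<k k<b))
  where
  fixed : J3 (suc a + t) ≡ suc a + t
  fixed = trans (sym (+-identityʳ _)) (J3-run t {0} h)

run-to-PHE : ∀ {a} t → J3 (suc a) + (1 + 2 * t) ≡ suc a
           → IsPureHighExtremal (suc a + t)
           × (∀ k → a < k → k ≤ suc a + t → ¬ IsFixedPoint k)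
           × (∀ {c} → c ≤ a → countPHE c (suc (suc a + t)) ≡ suc (countPHE c (suc a)))
run-to-PHE {a} t h = phe , ¬fixed , counted
  where
  phe : IsPureHighExtremal (suc a + t)
  phe = J3-run t {1} h
  ¬fixed : ∀ k → a < k → k ≤ suc a + t → ¬ IsFixedPoint k
  ¬fixed k a<k k≤p with m≤n⇒m<n∨m≡n k≤p
  ... | inj₁ k<p = deep⇒¬fixed (J3-run-deep {r = 1} h a<k k<p)
  ... | inj₂ refl = λ (_ , fixed) → m+1+n≢m k (trans (cong (_+ 1) (sym fixed)) phe)
  counted : ∀ {c} → c ≤ a → countPHE c (suc (suc a + t)) ≡ suc (countPHE c (suc a))
  counted {c} c≤a = trans (countPHE-hit (s≤s (≤-trans c≤a (m≤m+n a t))) phe)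
    (cong suc (countPHE-stable t (λ k a<k k<p → deep⇒¬PHE (J3-run-deep {r = 1} h a<k k<p))))

PHE-chain : ∀ j {s c p} → c ≤ p → IsPureHighExtremal p → suc p ≡ 2 ^ j * (1 + 2 * s)
          → ∃ λ b → Next IsFixedPoint p b × countPHE c b ≡ countPHE c (suc p) + j
                  × 2 * b + 1 ≡ 3 ^ suc j * (1 + 2 * s)
PHE-chain zero {s} {c} {p} c≤p phe e with suc-injective (trans e (*-identityˡ (1 + 2 * s)))
... | refl with run-to-fixed s (J3-gap-after-PHE phe)
...   | next , stable = suc p + s , next , trans (stable c) (sym (+-identityʳ _)) , formula s
  where
  formula : ∀ s → 2 * (suc (2 * s) + s) + 1 ≡ 3 ^ 1 * (1 + 2 * s)
  formula = solve-∀
PHE-chain (suc j) {s} {c} {p} c≤p phe e with even-or-odd p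
... | t , inj₁ refl =
  contradiction (trans (sym (*-assoc 2 (2 ^ j) (1 + 2 * s))) (sym e)) (even≢odd (2 ^ j * (1 + 2 * s)) t)
... | t , inj₂ refl with run-to-PHE t (J3-gap-after-PHE phe)
...   | phe′ , ¬fixed-upto-p′ , counted
  with PHE-chain j {1 + 3 * s} (≤-trans c≤p (m≤n⇒m≤1+n (m≤m+n _ t))) phe′ e′
  where
  half : 1 + t ≡ 2 ^ j * (1 + 2 * s)
  half = *-cancelˡ-≡ (1 + t) _ 2 (trans (double t) (trans e (*-assoc 2 (2 ^ j) (1 + 2 * s))))
    where
    double : ∀ t → 2 * (1 + t) ≡ suc (1 + 2 * t)
    double = solve-∀
  e′ : suc (suc (1 + 2 * t) + t) ≡ 2 ^ j * (1 + 2 * (1 + 3 * s))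
  e′ = begin
      suc (suc (1 + 2 * t) + t)      ≡⟨ triple t ⟩
      3 * (1 + t)                    ≡⟨ cong (3 *_) half ⟩
      3 * (2 ^ j * (1 + 2 * s))      ≡⟨ move-factor (2 ^ j) s ⟩
      2 ^ j * (1 + 2 * (1 + 3 * s))  ∎
    where
    open ≡-Reasoning
    triple : ∀ t → suc (suc (1 + 2 * t) + t) ≡ 3 * (1 + t)
    triple = solve-∀
    move-factor : ∀ X s → 3 * (X * (1 + 2 * s)) ≡ X * (1 + 2 * (1 + 3 * s))
    move-factor = solve-∀
...     | b , next , count , formula =
  b , Next-extendˡ (s≤s (m≤m+n _ t)) ¬fixed-upto-p′ next ,
  trans count (trans (cong (_+ j) (counted c≤p)) (sym (+-suc _ j))) ,
  trans formula (move-factor (3 ^ suc j) s)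
  where
  move-factor : ∀ X s → X * (1 + 2 * (1 + 3 * s)) ≡ 3 * X * (1 + 2 * s)
  move-factor = solve-∀

next-fixed-point : ∀ {n} → IsFixedPoint n → ∃ λ b → Next IsFixedPoint n b
                 × ∃₂ λ m s → countPHE n b ≡ m
                            × 3 * n + 2 ≡ 2 ^ m * (1 + 2 * s) × 2 * b + 1 ≡ 3 ^ m * (1 + 2 * s)
next-fixed-point {suc n} (_ , fixed) with even-or-odd n
... | t , inj₁ refl with run-to-fixed t (J3-gap-after-fixed (2 * t) fixed)
...   | next , stable =
  suc (suc (2 * t)) + t , next , 0 , 2 + 3 * t ,
  trans (stable (suc (2 * t))) (countPHE-empty (suc (2 * t)) _ ≤-refl) , y-odd t , b-odd t
  where
  y-odd : ∀ t → 3 * suc (2 * t) + 2 ≡ 2 ^ 0 * (1 + 2 * (2 + 3 * t))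
  y-odd = solve-∀
  b-odd : ∀ t → 2 * (suc (suc (2 * t)) + t) + 1 ≡ 3 ^ 0 * (1 + 2 * (2 + 3 * t))
  b-odd = solve-∀
next-fixed-point {suc n} (_ , fixed) | t , inj₂ refl
  with run-to-PHE t (J3-gap-after-fixed (1 + 2 * t) fixed)
...   | phe , ¬fixed-upto-p , counted with odd-part (suc (suc (1 + 2 * t)) + t)
...     | j , s , e with PHE-chain j {s} {suc (1 + 2 * t)} (≤-trans (n≤1+n _) (m≤m+n _ t)) phe e
...       | b , next , count , formula =
  b , Next-extendˡ (s≤s (m≤m+n _ t)) ¬fixed-upto-p next , suc j , s ,
  trans count (cong (_+ j) (trans (counted ≤-refl)
                                  (cong suc (countPHE-empty (suc (1 + 2 * t)) _ ≤-refl)))) ,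
  trans (y-even t) (trans (cong (2 *_) e) (sym (*-assoc 2 (2 ^ j) (1 + 2 * s)))) ,
  formula
  where
  y-even : ∀ t → 3 * suc (1 + 2 * t) + 2 ≡ 2 * suc (suc (suc (1 + 2 * t)) + t)
  y-even = solve-∀

theorem3 : (np : ℕ → ℕ)
    → (∀ ℓ → np ℓ < np (suc ℓ))
    → (∀ ℓ → IsFixedPoint (np ℓ))
    → (∀ n → IsFixedPoint n → ∃ λ ℓ → np ℓ ≡ n)
    → ∀ ℓ →
      let m = countPHE (np ℓ) (np (suc ℓ)) in
      ((2 ^ m ∣ 3 * np ℓ + 2) × (∀ k → 2 ^ k ∣ 3 * np ℓ + 2 → k ≤ m))
      × (2 ^ (m + 1) * np (suc ℓ) + 2 ^ m ≡ 3 ^ m * (3 * np ℓ + 2))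
theorem3 np np-< np-fixed np-onto ℓ with next-fixed-point (np-fixed ℓ)
... | b , next , m , s , count , y≡ , b≡
  rewrite enumeration-Next np np-< np-fixed np-onto ℓ next | count =
  max-power-of-2-dividing m s y≡ , power-formula m y≡ b≡
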